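{- Let $D=(S,C)$ be an ADF with arguments $S=\{s_1,\dots,s_n\}$ and acceptance conditions $C=\{\varphi_s\}_{s\in S}$. For each $s\in S$ let $\varphi_s^\top = dual(\varphi_s)$ and $\varphi_s^\bot = dual(\neg\varphi_s)$, and define the Boolean functions over the variables $s_1^\top,s_1^\bot,\dots,s_n^\top,s_n^\bot$: $$f_{ad}=\bigwedge_{s\in S}\big((\varphi_s^\top\Rightarrow s^\top)\land(\varphi_s^\bot\Rightarrow s^\bot)\big),$$ $$f_{co}=\bigwedge_{s\in S}\big((\varphi_s^\top\Rightarrow s^\top)\land(\varphi_s^\bot\Rightarrow s^\bot)\land((s^\top\land s^\bot)\Rightarrow(\varphi_s^\top\land\varphi_s^\bot))\big).$$ Then for every 3-valued interpretation $I$ of $D$, $f_{ad}$ evaluated on the dual encoding of $I$ equals $1$ if and only if $I$ is admissible, and $f_{co}$ evaluated on the dual encoding of $I$ equals $1$ if and only if $I$ is complete.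
   Context: An ADF (abstract dialectical framework) is a pair $D=(S,C)$ where $S$ is a finite set of arguments and $C=\{\varphi_s\}_{s\in S}$ assigns to each argument a propositional formula over the variables $S$ (built from variables, constants $0,1$, and connectives $\neg,\land,\lor,\Rightarrow,\Leftrightarrow$). A 3-valued interpretation is a map $I:S\to\{0,1,\star\}$ ($\star$ = unknown); it is 2-valued if it never takes value $\star$. The information ordering $\le_i$ on $\{0,1,\star\}$ is given by $\star\le_i 0$, $\star\le_i 1$ plus reflexivity; it extends pointwise to interpretations. For a formula $\varphi$ and interpretation $I$, the partial evaluation $\varphi[I]$ substitutes $I(s)$ for each $s$ with $I(s)\in\{0,1\}$. The characteristic operator $\Gamma_D$ maps $I$ to $I'$ where $I'(s)=1$ iff $\varphi_s[I]$ is a tautology, $I'(s)=0$ iff $\varphi_s[I]$ is unsatisfiable, and $I'(s)=\star$ otherwise. $I$ is admissible iff $I\le_i\Gamma_D(I)$, and complete iff $I=\Gamma_D(I)$. Dual encoding: each argument $s$ has two Boolean variables $(s^\top,s^\bot)$, and the value $1$ is encoded as $(1,0)$, $0$ as $(0,1)$, and $\star$ as $(1,1)$; the dual encoding of a 3-valued interpretation $I$ is the assignment of the $2n$ variables obtained this way. For a Boolean function $f$ over $s_1,\dots,s_n$, $dual(f)$ is the Boolean function over $s_1^\top,s_1^\bot,\dots,s_n^\top,s_n^\bot$ defined by $$dual(f)=\exists s_1,\dots,s_n.\ \Big(f(s_1,\dots,s_n)\land\bigwedge_{i=1}^n\big((s_i\Rightarrow s_i^\top)\land(\neg s_i\Rightarrow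 s_i^\bot)\big)\Big).$$ -}

module Defs where

open import Data.Nat using (ℕ; zero; suc)
open import Data.Fin using (Fin; zero; suc)
open import Data.Bool using (Bool; true; false; not; _∧_; _∨_; if_then_else_)
open import Data.Bool.Properties using (_≟_)
open import Data.Product using (_×_; _,_; proj₁; proj₂; ∃; ∃-syntax)
open import Data.Sum using (_⊎_; inj₁; inj₂)
open import Data.Vec using (Vec; []; _∷_; lookup; tabulate)
open import Relation.Binary.PropositionalEquality using (_≡_; refl)
open import Relation.Nullary using (Dec; yes; no; ¬_; does)

_⇒ᵇ_ : Bool → Bool → Bool
a ⇒ᵇ b = not a ∨ b

_⇔ᵇ_ : Bool → Bool → Bool
true  ⇔ᵇ b = b
false ⇔ᵇ b = not b

data Form (n : ℕ) : Set where
  var  : Fin n → Form n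
  ⊥f ⊤f : Form n
  ¬f_  : Form n → Form n
  _∧f_ _∨f_ _⇒f_ _⇔f_ : Form n → Form n → Form n

Assign : ℕ → Set
Assign n = Vec Bool n

eval : ∀ {n} → Assign n → Form n → Bool
eval v (var s)   = lookup v s
eval v ⊥f        = false
eval v ⊤f        = true
eval v (¬f φ)    = not (eval v φ)
eval v (φ ∧f ψ)  = eval v φ ∧ eval v ψ
eval v (φ ∨f ψ)  = eval v φ ∨ eval v ψ
eval v (φ ⇒f ψ)  = eval v φ ⇒ᵇ eval v ψ
eval v (φ ⇔f ψ)  = eval v φ ⇔ᵇ eval v ψ

Tautology : ∀ {n} → Form n → Set
Tautology {n} φ = (v : Assign n) → eval v φ ≡ true

Unsatisfiable : ∀ {n} → Form n → Set
Unsatisfiable {n} φ = (v : Assign n) → eval v φ ≡ false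

decAll : ∀ n (P : Assign n → Set) → (∀ v → Dec (P v)) → Dec (∀ v → P v)
decAll zero P d with d []
... | yes p = yes λ { [] → p }
... | no ¬p = no λ f → ¬p (f [])
decAll (suc n) P d
  with decAll n (λ w → P (true ∷ w)) (λ w → d (true ∷ w))
     | decAll n (λ w → P (false ∷ w)) (λ w → d (false ∷ w))
... | yes pt | yes pf = yes λ { (true ∷ w) → pt w ; (false ∷ w) → pf w }
... | no ¬pt | _      = no λ f → ¬pt (λ w → f (true ∷ w))
... | yes _  | no ¬pf = no λ f → ¬pf (λ w → f (false ∷ w))

decEx : ∀ n (P : Assign n → Set) → (∀ v → Dec (P v)) → Dec (∃[ v ] P v)
decEx zero P d with d []
... | yes p = yes ([] , p)
... | no ¬p = no λ { ([] , p) → ¬p p }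
decEx (suc n) P d
  with decEx n (λ w → P (true ∷ w)) (λ w → d (true ∷ w))
     | decEx n (λ w → P (false ∷ w)) (λ w → d (false ∷ w))
... | yes (w , p) | _ = yes (true ∷ w , p)
... | no _ | yes (w , p) = yes (false ∷ w , p)
... | no ¬pt | no ¬pf = no λ { (true ∷ w , p) → ¬pt (w , p) ; (false ∷ w , p) → ¬pf (w , p) }

decTaut : ∀ {n} (φ : Form n) → Dec (Tautology φ)
decTaut {n} φ = decAll n _ (λ v → eval v φ ≟ true)

decUnsat : ∀ {n} (φ : Form n) → Dec (Unsatisfiable φ)
decUnsat {n} φ = decAll n _ (λ v → eval v φ ≟ false)

ADF : ℕ → Set
ADF n = Fin n → Form n

data V3 : Set where
  v0 v1 ⋆ : V3

Interp : ℕ → Set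
Interp n = Fin n → V3

data _≤i_ : V3 → V3 → Set where
  ⋆≤ : ∀ {x} → ⋆ ≤i x
  refl≤ : ∀ {x} → x ≤i x

partialEval : ∀ {n} → Form n → Interp n → Form n
partialEval (var s) I with I s
... | v0 = ⊥f
... | v1 = ⊤f
... | ⋆  = var s
partialEval ⊥f I = ⊥f
partialEval ⊤f I = ⊤f
partialEval (¬f φ) I = ¬f partialEval φ I
partialEval (φ ∧f ψ) I = partialEval φ I ∧f partialEval ψ I
partialEval (φ ∨f ψ) I = partialEval φ I ∨f partialEval ψ I
partialEval (φ ⇒f ψ) I = partialEval φ I ⇒f partialEval ψ I
partialEval (φ ⇔f ψ) I = partialEval φ I ⇔f partialEval ψ I

Γ : ∀ {n} → ADF n → Interp n → Interp n
Γ D I s with decTaut (partialEval (D s) I) | decUnsat (partialEval (D s) I)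
... | yes _ | _     = v1
... | no _  | yes _ = v0
... | no _  | no _  = ⋆

Admissible : ∀ {n} → ADF n → Interp n → Set
Admissible D I = ∀ s → I s ≤i Γ D I s

Complete : ∀ {n} → ADF n → Interp n → Set
Complete D I = ∀ s → I s ≡ Γ D I s

BoolFun : ℕ → Set
BoolFun n = Assign n → Bool

-- assignments to the 2n dual variables; entry i is (s_i^⊤ , s_i^⊥)
DualAssign : ℕ → Set
DualAssign n = Vec (Bool × Bool) n

encV : V3 → Bool × Bool
encV v1 = true , false
encV v0 = false , true
encV ⋆  = true , true

enc : ∀ {n} → Interp n → DualAssign n
enc I = tabulate (λ s → encV (I s))

compat : ∀ {n} → Assign n → DualAssign n → Bool
compat [] [] = true
compat (b ∷ s) ((t , f) ∷ w) = ((b ⇒ᵇ t) ∧ (not b ⇒ᵇ f)) ∧ compat s w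

dual : ∀ {n} → BoolFun n → DualAssign n → Bool
dual {n} f w = does (decEx n (λ s → (f s ∧ compat s w) ≡ true) (λ s → (f s ∧ compat s w) ≟ true))

⋀ : ∀ {n} → (Fin n → Bool) → Bool
⋀ {zero} g = true
⋀ {suc n} g = g zero ∧ ⋀ (λ i → g (suc i))

φ⊤ φ⊥ : ∀ {n} → ADF n → Fin n → DualAssign n → Bool
φ⊤ D s = dual (λ v → eval v (D s))
φ⊥ D s = dual (λ v → not (eval v (D s)))

f-ad : ∀ {n} → ADF n → DualAssign n → Bool
f-ad D w = ⋀ λ s →
  (φ⊤ D s w ⇒ᵇ proj₁ (lookup w s)) ∧ (φ⊥ D s w ⇒ᵇ proj₂ (lookup w s))

f-co : ∀ {n} → ADF n → DualAssign n → Bool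
f-co D w = ⋀ λ s →
  ((φ⊤ D s w ⇒ᵇ proj₁ (lookup w s)) ∧ (φ⊥ D s w ⇒ᵇ proj₂ (lookup w s)))
  ∧ ((proj₁ (lookup w s) ∧ proj₂ (lookup w s)) ⇒ᵇ (φ⊤ D s w ∧ φ⊥ D s w))

{-# OPTIONS --safe #-}
module Submission where

open import Defs
open import Data.Nat using (ℕ; zero; suc)
open import Data.Bool using (Bool; true; false; not; _∧_; _∨_)
open import Data.Bool.Properties using (_≟_; ¬-not; not-¬; not-involutive; ∧-conicalˡ; ∧-conicalʳ)
open import Data.Fin using (Fin; zero; suc)
open import Data.Product using (_×_; _,_; proj₁; proj₂; ∃-syntax)
open import Data.Vec using ([]; _∷_; lookup; tabulate; replicate)
open import Data.Vec.Properties using (lookup∘tabulate)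
open import Function using (_∘_)
open import Function.Bundles using (_⇔_; mk⇔; Equivalence)
open import Relation.Nullary using (Dec; yes; no; ¬_)
open import Relation.Nullary.Decidable using (dec-true; dec-false)
open import Relation.Binary.PropositionalEquality using (_≡_; refl; sym; trans; cong; cong₂; subst)

-- The 2-valued assignments compatible with the dual encoding of I are exactly the
-- completions of I (⋆ filled in arbitrarily), and evaluating φ at a completion of I
-- is evaluating φ[I] at it. Hence φ⊤ holds at enc I iff φ[I] is satisfiable and φ⊥
-- iff φ[I] is falsifiable, i.e. (φ⊤, φ⊥) at enc I is the encoding of Γ(I)(s). The
-- encoding reverses ≤i componentwise, so the conjuncts of f-ad and f-co say exactly
-- I s ≤i Γ(I)(s) and I s ≡ Γ(I)(s).

instantiateV : V3 → Bool → Bool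
instantiateV v0 b = false
instantiateV v1 b = true
instantiateV ⋆  b = b

instantiate : ∀ {n} → Interp n → Assign n → Assign n
instantiate I v = tabulate λ s → instantiateV (I s) (lookup v s)

eval-partialEval : ∀ {n} (φ : Form n) (I : Interp n) (v : Assign n) →
  eval v (partialEval φ I) ≡ eval (instantiate I v) φ
eval-partialEval (var s) I v
  rewrite lookup∘tabulate (λ s → instantiateV (I s) (lookup v s)) s with I s
... | v0 = refl
... | v1 = refl
... | ⋆  = refl
eval-partialEval ⊥f I v = refl
eval-partialEval ⊤f I v = refl
eval-partialEval (¬f φ) I v = cong not (eval-partialEval φ I v)
eval-partialEval (φ ∧f ψ) I v = cong₂ _∧_ (eval-partialEval φ I v) (eval-partialEval ψ I v)
eval-partialEval (φ ∨f ψ) I v = cong₂ _∨_ (eval-partialEval φ I v) (eval-partialEval ψ I v)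
eval-partialEval (φ ⇒f ψ) I v = cong₂ _⇒ᵇ_ (eval-partialEval φ I v) (eval-partialEval ψ I v)
eval-partialEval (φ ⇔f ψ) I v = cong₂ _⇔ᵇ_ (eval-partialEval φ I v) (eval-partialEval ψ I v)

compatV : Bool → Bool × Bool → Bool
compatV b w = (b ⇒ᵇ proj₁ w) ∧ (not b ⇒ᵇ proj₂ w)

compatV-encV⇒instantiateV : ∀ x b → compatV b (encV x) ≡ true → instantiateV x b ≡ b
compatV-encV⇒instantiateV v0 false _ = refl
compatV-encV⇒instantiateV v1 true  _ = refl
compatV-encV⇒instantiateV ⋆  b     _ = refl

compatV-instantiateV : ∀ x b → compatV (instantiateV x b) (encV x) ≡ true
compatV-instantiateV v0 b     = refl
compatV-instantiateV v1 b     = refl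
compatV-instantiateV ⋆  true  = refl
compatV-instantiateV ⋆  false = refl

compat-enc⇒instantiate : ∀ {n} (I : Interp n) (v : Assign n) →
  compat v (enc I) ≡ true → instantiate I v ≡ v
compat-enc⇒instantiate {zero}  I []      _ = refl
compat-enc⇒instantiate {suc n} I (b ∷ v) c = cong₂ _∷_
  (compatV-encV⇒instantiateV (I zero) b (∧-conicalˡ _ _ c))
  (compat-enc⇒instantiate (I ∘ suc) v (∧-conicalʳ _ _ c))

compat-instantiate : ∀ {n} (I : Interp n) (v : Assign n) →
  compat (instantiate I v) (enc I) ≡ true
compat-instantiate {zero}  I []      = refl
compat-instantiate {suc n} I (b ∷ v) =
  cong₂ _∧_ (compatV-instantiateV (I zero) b) (compat-instantiate (I ∘ suc) v)

dual-enc≡false⇔ : ∀ {n} (F : BoolFun n) (I : Interp n) →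
  (dual F (enc I) ≡ false) ⇔ (∀ v → F (instantiate I v) ≡ false)
dual-enc≡false⇔ {n} F I = mk⇔ to from
  where
  witness? : Dec (∃[ v ] (F v ∧ compat v (enc I)) ≡ true)
  witness? = decEx n _ (λ v → (F v ∧ compat v (enc I)) ≟ true)

  to : dual F (enc I) ≡ false → ∀ v → F (instantiate I v) ≡ false
  to noWitness v = ¬-not λ Fv≡true →
    not-¬ (dec-true witness? (instantiate I v , cong₂ _∧_ Fv≡true (compat-instantiate I v)))
      noWitness

  from : (∀ v → F (instantiate I v) ≡ false) → dual F (enc I) ≡ false
  from F≡false = dec-false witness? λ (v , Fv∧compat) →
    not-¬ (∧-conicalˡ _ _ Fv∧compat)
      (subst (λ u → F u ≡ false) (compat-enc⇒instantiate I v (∧-conicalʳ _ _ Fv∧compat))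
        (F≡false v))

admitsᵇ : Bool × Bool → Bool × Bool → Bool
admitsᵇ γ w = (proj₁ γ ⇒ᵇ proj₁ w) ∧ (proj₂ γ ⇒ᵇ proj₂ w)

agreesᵇ : Bool × Bool → Bool × Bool → Bool
agreesᵇ γ w = admitsᵇ γ w ∧ ((proj₁ w ∧ proj₂ w) ⇒ᵇ (proj₁ γ ∧ proj₂ γ))

admitsᵇ-encV⇔≤i : ∀ x g → (admitsᵇ (encV g) (encV x) ≡ true) ⇔ (x ≤i g)
admitsᵇ-encV⇔≤i x g = mk⇔ (to x g) from
  where
  to : ∀ x g → admitsᵇ (encV g) (encV x) ≡ true → x ≤i g
  to v0 v0 _ = refl≤
  to v1 v1 _ = refl≤
  to ⋆  g  _ = ⋆≤
  to v0 v1 ()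
  to v0 ⋆  ()
  to v1 v0 ()
  to v1 ⋆  ()

  from : ∀ {x g} → x ≤i g → admitsᵇ (encV g) (encV x) ≡ true
  from {g = v0} ⋆≤    = refl
  from {g = v1} ⋆≤    = refl
  from {g = ⋆}  ⋆≤    = refl
  from {v0}     refl≤ = refl
  from {v1}     refl≤ = refl
  from {⋆}      refl≤ = refl

agreesᵇ-encV⇔≡ : ∀ x g → (agreesᵇ (encV g) (encV x) ≡ true) ⇔ (x ≡ g)
agreesᵇ-encV⇔≡ x g = mk⇔ (to x g) from
  where
  to : ∀ x g → agreesᵇ (encV g) (encV x) ≡ true → x ≡ g
  to v0 v0 _ = refl
  to v1 v1 _ = refl
  to ⋆  ⋆  _ = refl
  to v0 v1 ()
  to v0 ⋆  ()
  to v1 v0 ()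
  to v1 ⋆  ()
  to ⋆  v0 ()
  to ⋆  v1 ()

  from : ∀ {x g} → x ≡ g → agreesᵇ (encV g) (encV x) ≡ true
  from {v0} refl = refl
  from {v1} refl = refl
  from {⋆}  refl = refl

⋀-cong : ∀ {n} {g h : Fin n → Bool} → (∀ s → g s ≡ h s) → ⋀ g ≡ ⋀ h
⋀-cong {zero}  g≡h = refl
⋀-cong {suc n} g≡h = cong₂ _∧_ (g≡h zero) (⋀-cong (g≡h ∘ suc))

⋀-true⇔ : ∀ {n} {g : Fin n → Bool} {P : Fin n → Set} →
  (∀ s → (g s ≡ true) ⇔ P s) → (⋀ g ≡ true) ⇔ (∀ s → P s)
⋀-true⇔ {zero}  g⇔P = mk⇔ (λ _ ()) (λ _ → refl)
⋀-true⇔ {suc n} {g} {P} g⇔P = mk⇔ to from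
  where
  tail⇔ : (⋀ (g ∘ suc) ≡ true) ⇔ (∀ s → P (suc s))
  tail⇔ = ⋀-true⇔ (g⇔P ∘ suc)

  to : ⋀ g ≡ true → ∀ s → P s
  to e zero    = Equivalence.to (g⇔P zero) (∧-conicalˡ _ _ e)
  to e (suc s) = Equivalence.to tail⇔ (∧-conicalʳ _ _ e) s

  from : (∀ s → P s) → ⋀ g ≡ true
  from all =
    cong₂ _∧_ (Equivalence.from (g⇔P zero) (all zero)) (Equivalence.from tail⇔ (all ∘ suc))

module _ {n} (D : ADF n) (I : Interp n) where

  -- Stated for the value false: both sides are then universal, so no witness has to
  -- be extracted from a negated tautology.
  φ⊤-enc≡false⇔ : ∀ s → (φ⊤ D s (enc I) ≡ false) ⇔ Unsatisfiable (partialEval (D s) I)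
  φ⊤-enc≡false⇔ s = mk⇔
    (λ h v → trans (eval-partialEval (D s) I v) (Equivalence.to (dual-enc≡false⇔ _ I) h v))
    (λ u → Equivalence.from (dual-enc≡false⇔ _ I)
      λ v → trans (sym (eval-partialEval (D s) I v)) (u v))

  φ⊥-enc≡false⇔ : ∀ s → (φ⊥ D s (enc I) ≡ false) ⇔ Tautology (partialEval (D s) I)
  φ⊥-enc≡false⇔ s = mk⇔
    (λ h v → trans (eval-partialEval (D s) I v)
      (trans (sym (not-involutive _)) (cong not (Equivalence.to (dual-enc≡false⇔ _ I) h v))))
    (λ t → Equivalence.from (dual-enc≡false⇔ _ I)
      λ v → cong not (trans (sym (eval-partialEval (D s) I v)) (t v)))

  φ-enc≡encV-Γ : ∀ s → (φ⊤ D s (enc I) , φ⊥ D s (enc I)) ≡ encV (Γ D I s)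
  φ-enc≡encV-Γ s with decTaut (partialEval (D s) I) | decUnsat (partialEval (D s) I)
  ... | yes t | _     = cong₂ _,_ (¬-not (¬unsat ∘ Equivalence.to (φ⊤-enc≡false⇔ s)))
                                  (Equivalence.from (φ⊥-enc≡false⇔ s) t)
    where
    ¬unsat : ¬ Unsatisfiable (partialEval (D s) I)
    ¬unsat u = not-¬ (t (replicate n false)) (u (replicate n false))
  ... | no ¬t | yes u = cong₂ _,_ (Equivalence.from (φ⊤-enc≡false⇔ s) u)
                                  (¬-not (¬t ∘ Equivalence.to (φ⊥-enc≡false⇔ s)))
  ... | no ¬t | no ¬u = cong₂ _,_ (¬-not (¬u ∘ Equivalence.to (φ⊤-enc≡false⇔ s)))
                                  (¬-not (¬t ∘ Equivalence.to (φ⊥-enc≡false⇔ s)))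

  f-ad-enc : f-ad D (enc I) ≡ ⋀ λ s → admitsᵇ (encV (Γ D I s)) (encV (I s))
  f-ad-enc = ⋀-cong λ s →
    cong₂ admitsᵇ (φ-enc≡encV-Γ s) (lookup∘tabulate (encV ∘ I) s)

  f-co-enc : f-co D (enc I) ≡ ⋀ λ s → agreesᵇ (encV (Γ D I s)) (encV (I s))
  f-co-enc = ⋀-cong λ s →
    cong₂ agreesᵇ (φ-enc≡encV-Γ s) (lookup∘tabulate (encV ∘ I) s)

proposition1 : (n : ℕ) (D : ADF n) (I : Interp n) →
    ((f-ad D (enc I) ≡ true) ⇔ Admissible D I)
    × ((f-co D (enc I) ≡ true) ⇔ Complete D I)
proposition1 n D I =
    subst (λ b → (b ≡ true) ⇔ Admissible D I) (sym (f-ad-enc D I))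
      (⋀-true⇔ λ s → admitsᵇ-encV⇔≤i (I s) (Γ D I s))
  , subst (λ b → (b ≡ true) ⇔ Complete D I) (sym (f-co-enc D I))
      (⋀-true⇔ λ s → agreesᵇ-encV⇔≡ (I s) (Γ D I s))
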